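{- Let $q$ be a prime power, $n$ a positive integer and $d_1<\cdots<d_k$ divisors of $n$. Let $a_i\in\mathbb{F}_{q^{d_i}}^*$ for $1\le i\le k$, and write $d_{i,j}=\gcd(d_i,d_j)$. If $N_{d_i/d_{i,j}}(a_i)=N_{d_j/d_{i,j}}(a_j)$ for all $1\le i,j\le k$, then there exists $\alpha\in\mathbb{F}_{q^n}^*$ with $N_{n/d_i}(\alpha)=a_i$ for all $1\le i\le k$; moreover, in this case $$\#\{\alpha\in\mathbb{F}_{q^n}^*: N_{n/d_i}(\alpha)=a_i,\ 1\le i\le k\}=\gcd\left(\frac{q^n-1}{q^{d_1}-1},\ldots,\frac{q^n-1}{q^{d_k}-1}\right).$$
   Context: For a divisor $d$ of $m$ and $\alpha\in\mathbb{F}_{q^m}^*$, $N_{m/d}(\alpha)=\alpha^{(q^m-1)/(q^d-1)}$ denotes the norm of $\alpha$ from $\mathbb{F}_{q^m}$ to $\mathbb{F}_{q^d}$. -}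

module Defs where

open import Level using (_⊔_)
open import Data.Nat using (ℕ; zero; suc; _^_; _∸_; _≤_)
open import Data.Nat.DivMod using (_/_)
open import Data.Nat.Primality using (Prime)
open import Data.Product using (Σ; ∃; _×_; _,_)
open import Data.List using (List; length; filter)
open import Data.List.Relation.Unary.Any using (Any)
open import Data.List.Relation.Unary.AllPairs using (AllPairs)
open import Data.Fin using (Fin)
open import Data.Fin.Properties using (all?)
open import Relation.Nullary using (¬_; Dec)
open import Relation.Nullary.Decidable using (_×-dec_; ¬?)
open import Relation.Binary.PropositionalEquality using (_≡_)
open import Relation.Binary using (Decidable)
open import Algebra.Bundles using (CommutativeRing)

IsPrimePower : ℕ → Set
IsPrimePower q = Σ ℕ λ p → Σ ℕ λ e → Prime p × 1 ≤ e × q ≡ p ^ e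

-- natural-number division, with the (never used) convention m div 0 = 0
_div_ : ℕ → ℕ → ℕ
m div zero    = 0
m div (suc k) = m / suc k

module FieldNotions {c ℓ} (F : CommutativeRing c ℓ) where
  open CommutativeRing F

  pow : Carrier → ℕ → Carrier
  pow x zero    = 1#
  pow x (suc k) = x * pow x k

  IsField : Set (c ⊔ ℓ)
  IsField = (¬ (0# ≈ 1#)) × (∀ x → ¬ (x ≈ 0#) → ∃ λ y → x * y ≈ 1#)

  IsEnumeration : List Carrier → Set (c ⊔ ℓ)
  IsEnumeration xs = (∀ x → Any (x ≈_) xs) × AllPairs (λ a b → ¬ (a ≈ b)) xs

  -- x ∈ F_{q^d}^*  (the subfield of F fixed by x ↦ x^{q^d}), x nonzero
  InUnitsOfSubfield : ℕ → ℕ → Carrier → Set ℓ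
  InUnitsOfSubfield q d x = (pow x (q ^ d) ≈ x) × (¬ (x ≈ 0#))

  norm : ℕ → ℕ → ℕ → Carrier → Carrier
  norm q m d x = pow x ((q ^ m ∸ 1) div (q ^ d ∸ 1))

  IsSolution : ℕ → ℕ → (k : ℕ) → (Fin k → ℕ) → (Fin k → Carrier) → Carrier → Set ℓ
  IsSolution q n k d a α = (¬ (α ≈ 0#)) × (∀ i → norm q n (d i) α ≈ a i)

  isSolution? : Decidable _≈_ → ∀ q n k d a → (α : Carrier) → Dec (IsSolution q n k d a α)
  isSolution? _≈?_ q n k d a α =
    ¬? (α ≈? 0#) ×-dec all? (λ i → norm q n (d i) α ≈? a i)

  countSolutions : Decidable _≈_ → List Carrier → ∀ q n k → (Fin k → ℕ) → (Fin k → Carrier) → ℕ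
  countSolutions _≈?_ xs q n k d a = length (filter (isSolution? _≈?_ q n k d a) xs)

{-# OPTIONS --safe #-}
module Submission where

open import Defs
open import Algebra.Bundles using (CommutativeRing)

-- Put N = q^n − 1 and e_i = N / (q^{d_i} − 1), so that N_{n/d_i}(α) = α^{e_i}.  Two equations
-- α^e = a and α^{e'} = b whose right-hand sides are compatible (e x = e' y implies a^x = b^y)
-- are equivalent to the single equation α^g = c with g = gcd(e, e'): writing e = g m and
-- e' = g n with m, n coprime, c is the common root of c^m = a and c^n = b obtained from a
-- Bézout identity.  Since gcd(q^a − 1, q^b − 1) = q^{gcd(a,b)} − 1, the hypothesis on the
-- norms is exactly this compatibility, so the system becomes α^h = c with
-- h = gcd(e_1, …, e_k), h ∣ N and c^{N/h} = 1.  Such an equation has at most h roots, as a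
-- polynomial of degree h, and at least h: by Lagrange α^N = 1, so α ↦ α^h maps F^* into the
-- at most N/h roots of y^{N/h} = 1 with fibres of size at most h, and the fibre over c has at
-- least N − h (N/h − 1) = h elements.

module Arithmetic where

  open import Data.Nat using (ℕ; zero; suc; _+_; _*_; _^_; _∸_; _≤_; NonZero; NonTrivial; ≢-nonZero;
    ≢-nonZero⁻¹; n>1⇒nonTrivial; nonTrivial⇒n>1; nonTrivial⇒nonZero; nonTrivial⇒≢1)
  import Data.Nat.Properties as ℕ
  open import Data.Nat.DivMod using (_/_; m/n*n≡m)
  open import Data.Nat.Divisibility using (_∣_; divides; quotient; m∣n⇒n≡quotient*m; ∣-trans;
    ∣-refl; ∣-antisym; _∣0; ∣m∣n⇒∣m+n; ∣m+n∣m⇒∣n; ∣n⇒∣m*n; 0∣⇒≡0)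
  open import Data.Nat.GCD using (gcd; gcd-GCD; module Bézout; gcd[m,n]∣m; gcd[m,n]∣n; gcd-greatest;
    gcd[m,n]≢0)
  open import Data.Nat.Coprimality using (coprime-/gcd; coprime-divisor)
  open import Data.Nat.Primality using (prime⇒nonTrivial; prime⇒nonZero)
  open import Data.Product using (∃; _×_; _,_)
  open import Data.Sum using (inj₁; [_,_]′)
  open import Relation.Binary.PropositionalEquality as ≡ using (_≡_)

  div≡/ : ∀ m n .{{_ : NonZero n}} → m div n ≡ m / n
  div≡/ m (suc n) = ≡.refl

  gcd≢0ˡ : ∀ m n .{{_ : NonZero m}} → NonZero (gcd m n)
  gcd≢0ˡ m n = ≢-nonZero (gcd[m,n]≢0 m n (inj₁ (≢-nonZero⁻¹ m)))

  prime-power⇒nonTrivial : ∀ {q} → IsPrimePower q → NonTrivial q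
  prime-power⇒nonTrivial (p , e , p-prime , 1≤e , ≡.refl) = n>1⇒nonTrivial (begin-strict
    1        <⟨ nonTrivial⇒n>1 p {{prime⇒nonTrivial p-prime}} ⟩
    p        ≡⟨ ℕ.*-identityʳ p ⟨
    p ^ 1    ≤⟨ ℕ.^-monoʳ-≤ p {{prime⇒nonZero p-prime}} 1≤e ⟩
    p ^ e    ∎)
    where open ℕ.≤-Reasoning

  -- m = r g and n = s g with r, s coprime, so x s = y r forces x = r t and y = s t.
  proportional⇒multiples : ∀ m n {x y} .{{_ : NonZero m}} → x * n ≡ y * m →
                           ∃ λ t → x ≡ m div gcd m n * t × y ≡ n div gcd m n * t
  proportional⇒multiples m n {x} {y} xn≡ym =
    t , ≡.trans x≡rt (≡.cong (_* t) (≡.sym (div≡/ m g)))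
      , ≡.trans y≡st (≡.cong (_* t) (≡.sym (div≡/ n g)))
    where
    open ≡.≡-Reasoning
    g : ℕ
    g = gcd m n
    instance
      g≢0 : NonZero g
      g≢0 = gcd≢0ˡ m n
    r s : ℕ
    r = m / g
    s = n / g
    instance
      r≢0 : NonZero r
      r≢0 = ≢-nonZero λ r≡0 →
        ≢-nonZero⁻¹ m (≡.trans (≡.sym (m/n*n≡m (gcd[m,n]∣m m n))) (≡.cong (_* g) r≡0))
    xs≡yr : x * s ≡ y * r
    xs≡yr = ℕ.*-cancelʳ-≡ (x * s) (y * r) g (begin
      x * s * g    ≡⟨ ℕ.*-assoc x s g ⟩
      x * (s * g)  ≡⟨ ≡.cong (x *_) (m/n*n≡m (gcd[m,n]∣n m n)) ⟩
      x * n        ≡⟨ xn≡ym ⟩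
      y * m        ≡⟨ ≡.cong (y *_) (m/n*n≡m (gcd[m,n]∣m m n)) ⟨
      y * (r * g)  ≡⟨ ℕ.*-assoc y r g ⟨
      y * r * g    ∎)
    r∣x : r ∣ x
    r∣x = coprime-divisor (coprime-/gcd m n) (divides y (≡.trans (ℕ.*-comm s x) xs≡yr))
    t : ℕ
    t = quotient r∣x
    x≡rt : x ≡ r * t
    x≡rt = ≡.trans (m∣n⇒n≡quotient*m r∣x) (ℕ.*-comm t r)
    y≡st : y ≡ s * t
    y≡st = ℕ.*-cancelˡ-≡ y (s * t) r (begin
      r * y        ≡⟨ ℕ.*-comm r y ⟩
      y * r        ≡⟨ xs≡yr ⟨
      x * s        ≡⟨ ≡.cong (_* s) x≡rt ⟩
      r * t * s    ≡⟨ ℕ.*-assoc r t s ⟩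
      r * (t * s)  ≡⟨ ≡.cong (r *_) (ℕ.*-comm t s) ⟩
      r * (s * t)  ∎)

  cross-multiply : ∀ {e e' g m n} → e ≡ g * m → e' ≡ g * n → e * n ≡ e' * m
  cross-multiply {g = g} {m} {n} ≡.refl ≡.refl = begin
    g * m * n    ≡⟨ ℕ.*-assoc g m n ⟩
    g * (m * n)  ≡⟨ ≡.cong (g *_) (ℕ.*-comm m n) ⟩
    g * (n * m)  ≡⟨ ℕ.*-assoc g n m ⟨
    g * n * m    ∎
    where open ≡.≡-Reasoning

  rescale : ∀ {E x g y d k} → E * x ≡ g * y → d ≡ g * k → E * (x * k) ≡ d * y
  rescale {E} {x} {g} {y} {k = k} Ex≡gy ≡.refl = begin
    E * (x * k)  ≡⟨ ℕ.*-assoc E x k ⟨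
    E * x * k    ≡⟨ ≡.cong (_* k) Ex≡gy ⟩
    g * y * k    ≡⟨ cross-multiply {g = g} ≡.refl ≡.refl ⟩
    g * k * y    ∎
    where open ≡.≡-Reasoning

  *-proportion : ∀ {e e' m n x y} → e * m ≡ e' * n → e * x ≡ e' * y → e * (x * n) ≡ e * (y * m)
  *-proportion {e} {e'} {m} {n} {x} {y} em≡e'n ex≡e'y = begin
    e * (x * n)  ≡⟨ ℕ.*-assoc e x n ⟨
    e * x * n    ≡⟨ ≡.cong (_* n) ex≡e'y ⟩
    e' * y * n   ≡⟨ cross-multiply {g = e'} ≡.refl ≡.refl ⟩
    e' * n * y   ≡⟨ ≡.cong (_* y) em≡e'n ⟨
    e * m * y    ≡⟨ ℕ.*-assoc e m y ⟩
    e * (m * y)  ≡⟨ ≡.cong (e *_) (ℕ.*-comm m y) ⟩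
    e * (y * m)  ∎
    where open ≡.≡-Reasoning

  pigeonhole-≤ : ∀ {g M t F L} → suc t ≤ M → g * M ≡ F + L → L ≤ g * t → g ≤ F
  pigeonhole-≤ {g} {M} {t} {F} {L} t<M gM≡F+L L≤gt = ℕ.+-cancelʳ-≤ (g * t) g F (begin
    g + g * t    ≡⟨ ℕ.*-suc g t ⟨
    g * suc t    ≤⟨ ℕ.*-monoʳ-≤ g t<M ⟩
    g * M        ≡⟨ gM≡F+L ⟩
    F + L        ≤⟨ ℕ.+-monoʳ-≤ F L≤gt ⟩
    F + g * t    ∎)
    where open ℕ.≤-Reasoning

  module PowerMinusOne (q : ℕ) .{{_ : NonTrivial q}} where

    private instance
      q≢0 : NonZero q
      q≢0 = nonTrivial⇒nonZero q

    Q : ℕ → ℕ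
    Q d = q ^ d ∸ 1

    suc-Q : ∀ d → suc (Q d) ≡ q ^ d
    suc-Q d = ℕ.suc-pred (q ^ d) {{ℕ.m^n≢0 q d}}

    Q-+ : ∀ m n → Q (m + n) ≡ q ^ m * Q n + Q m
    Q-+ m n = ℕ.suc-injective (begin
      suc (Q (m + n))            ≡⟨ suc-Q (m + n) ⟩
      q ^ (m + n)                ≡⟨ ℕ.^-distribˡ-+-* q m n ⟩
      q ^ m * q ^ n              ≡⟨ ≡.cong (q ^ m *_) (suc-Q n) ⟨
      q ^ m * suc (Q n)          ≡⟨ ℕ.*-suc (q ^ m) (Q n) ⟩
      q ^ m + q ^ m * Q n        ≡⟨ ≡.cong (_+ q ^ m * Q n) (suc-Q m) ⟨
      suc (Q m + q ^ m * Q n)    ≡⟨ ≡.cong suc (ℕ.+-comm (Q m) (q ^ m * Q n)) ⟩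
      suc (q ^ m * Q n + Q m)    ∎)
      where open ≡.≡-Reasoning

    Q∣Q[t*m] : ∀ m t → Q m ∣ Q (t * m)
    Q∣Q[t*m] m zero    = Q m ∣0
    Q∣Q[t*m] m (suc t) = ≡.subst (Q m ∣_) (≡.sym (Q-+ m (t * m)))
      (∣m∣n⇒∣m+n (∣n⇒∣m*n (q ^ m) (Q∣Q[t*m] m t)) ∣-refl)

    Q-mono-∣ : ∀ {m n} → m ∣ n → Q m ∣ Q n
    Q-mono-∣ {m} (divides t ≡.refl) = Q∣Q[t*m] m t

    private
      ∣Q-Bézout : ∀ {d g m n} x y → g + y * n ≡ x * m → d ∣ Q m → d ∣ Q n → d ∣ Q g
      ∣Q-Bézout {d} {g} {m} {n} x y g+yn≡xm d∣Qm d∣Qn = ∣m+n∣m⇒∣n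
        (≡.subst (d ∣_) (≡.trans (≡.cong Q (≡.sym g+yn≡xm)) (Q-+ g (y * n)))
        (∣-trans d∣Qm (Q∣Q[t*m] m x)))
        (∣n⇒∣m*n (q ^ g) (∣-trans d∣Qn (Q∣Q[t*m] n y)))

    Q-gcd : ∀ m n → Q (gcd m n) ≡ gcd (Q m) (Q n)
    Q-gcd m n = ∣-antisym
      (gcd-greatest (Q-mono-∣ (gcd[m,n]∣m m n)) (Q-mono-∣ (gcd[m,n]∣n m n)))
      (gcd∣Q (Bézout.identity (gcd-GCD m n)))
      where
      gcd∣Q : Bézout.Identity (gcd m n) m n → gcd (Q m) (Q n) ∣ Q (gcd m n)
      gcd∣Q (Bézout.+- x y eq) = ∣Q-Bézout x y eq (gcd[m,n]∣m (Q m) (Q n)) (gcd[m,n]∣n (Q m) (Q n))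
      gcd∣Q (Bézout.-+ x y eq) = ∣Q-Bézout y x eq (gcd[m,n]∣n (Q m) (Q n)) (gcd[m,n]∣m (Q m) (Q n))

    Q≢0 : ∀ d .{{_ : NonZero d}} → NonZero (Q d)
    Q≢0 d = ≢-nonZero λ Qd≡0 → [ ≢-nonZero⁻¹ d , nonTrivial⇒≢1 ]′
      (ℕ.m^n≡1⇒n≡0∨m≡1 q d (≡.trans (≡.sym (suc-Q d)) (≡.cong suc Qd≡0)))

    Q-div*Q≡Q : ∀ {d n} .{{_ : NonZero n}} → d ∣ n → Q n div Q d * Q d ≡ Q n
    Q-div*Q≡Q {d} {n} d∣n = ≡.trans (≡.cong (_* Q d) (div≡/ (Q n) (Q d))) (m/n*n≡m (Q-mono-∣ d∣n))
      where
      instance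
        d≢0 : NonZero d
        d≢0 = ≢-nonZero λ d≡0 → ≢-nonZero⁻¹ n (0∣⇒≡0 (≡.subst (_∣ n) d≡0 d∣n))
        Qd≢0 : NonZero (Q d)
        Qd≢0 = Q≢0 d

module ListCounting where

  open import Level using (Level)
  open import Data.Nat using (ℕ; suc; _+_; _*_; _≤_; _<_; z≤n)
  import Data.Nat.Properties as ℕ
  open import Data.List using (List; []; _∷_; _++_; length; filter)
  open import Data.List.Relation.Unary.All as All using (All; []; _∷_)
  open import Data.List.Relation.Unary.All.Properties using (all-filter)
    renaming (filter⁺ to All-filter⁺)
  open import Data.List.Relation.Unary.Any using (here; there)
  open import Data.List.Relation.Binary.Sublist.Propositional.Properties using (filter-⊆; length-mono-≤)
    renaming (filter⁺ to Sublist-filter⁺)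
  open import Data.Product using (∃; _,_)
  open import Function using (id)
  open import Relation.Binary.Bundles using (Setoid; DecSetoid)
  open import Relation.Binary.PropositionalEquality as ≡ using (_≡_)
  open import Relation.Nullary using (yes; no; contradiction)
  open import Relation.Unary as U using (Pred)
  open import Relation.Unary.Properties using (∁?)

  private variable a b ℓ p q : Level

  module _ {A : Set a} {P : Pred A p} (P? : U.Decidable P) where

    length-filter+length-filter-∁ : ∀ xs →
                                    length (filter P? xs) + length (filter (∁? P?) xs) ≡ length xs
    length-filter+length-filter-∁ []       = ≡.refl
    length-filter+length-filter-∁ (x ∷ xs) with P? x
    ... | yes _ = ≡.cong suc (length-filter+length-filter-∁ xs)
    ... | no  _ = ≡.trans (ℕ.+-suc _ _) (≡.cong suc (length-filter+length-filter-∁ xs))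

    length-filter>0⇒∃ : ∀ xs → 0 < length (filter P? xs) → ∃ P
    length-filter>0⇒∃ xs 0<length with filter P? xs | all-filter P? xs
    ... | y ∷ _ | Py ∷ _ = y , Py

    length-filter-filter≤ : ∀ {Q : Pred A q} (Q? : U.Decidable Q) xs →
                            length (filter Q? (filter P? xs)) ≤ length (filter Q? xs)
    length-filter-filter≤ Q? xs =
      length-mono-≤ (Sublist-filter⁺ Q? Q? (λ { ≡.refl → id }) (filter-⊆ P? xs))

  module _ (S : Setoid a ℓ) where
    open Setoid S using (Carrier; refl; sym; trans)
    open import Data.List.Relation.Unary.Unique.Setoid S using (Unique; _∷_; head; tail)
    open import Data.List.Membership.Setoid S using (_∈_)
    open import Data.List.Membership.Setoid.Properties using (∈-∃++; All[≉]⇒∉; ∈-resp-≈)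
    open import Data.List.Relation.Binary.Subset.Setoid S using (_⊆_)
    open import Data.List.Relation.Binary.Permutation.Setoid S
      using (_↭_; prep; ↭-refl; ↭-sym; ↭-trans; ↭-reflexive-≋)
    open import Data.List.Relation.Binary.Permutation.Setoid.Properties S
      using (shift; ∈-resp-↭; Unique-resp-↭)

    unique-⊆-⊇⇒↭ : ∀ {xs ys} → Unique xs → Unique ys → xs ⊆ ys → ys ⊆ xs → xs ↭ ys
    unique-⊆-⊇⇒↭ {[]}     {[]}     _ _ _ _ = ↭-refl
    unique-⊆-⊇⇒↭ {[]}     {y ∷ ys} _ _ _ ys⊆[] with ys⊆[] (here refl)
    ... | ()
    unique-⊆-⊇⇒↭ {x ∷ xs} {ys} (x≉xs ∷ xs-unique) ys-unique xs⊆ys ys⊆xs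
      with ∈-∃++ S (xs⊆ys (here refl))
    ... | as , bs , w , x≈w , ys≋ =
      ↭-trans (prep x≈w (unique-⊆-⊇⇒↭ xs-unique (tail w∷rest-unique) xs⊆rest rest⊆xs))
              (↭-sym ys↭w∷rest)
      where
      rest : List Carrier
      rest = as ++ bs
      ys↭w∷rest : ys ↭ w ∷ rest
      ys↭w∷rest = ↭-trans (↭-reflexive-≋ ys≋) (shift refl as bs)
      w∷rest-unique : Unique (w ∷ rest)
      w∷rest-unique = Unique-resp-↭ ys↭w∷rest ys-unique
      xs⊆rest : xs ⊆ rest
      xs⊆rest z∈xs with ∈-resp-↭ ys↭w∷rest (xs⊆ys (there z∈xs))
      ... | here z≈w     = contradiction (∈-resp-≈ S (trans z≈w (sym x≈w)) z∈xs)
                                         (All[≉]⇒∉ S x≉xs)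
      ... | there z∈rest = z∈rest
      rest⊆xs : rest ⊆ xs
      rest⊆xs z∈rest with ys⊆xs (∈-resp-↭ (↭-sym ys↭w∷rest) (there z∈rest))
      ... | here z≈x   = contradiction (∈-resp-≈ S (trans z≈x x≈w) z∈rest)
                                       (All[≉]⇒∉ S (head w∷rest-unique))
      ... | there z∈xs = z∈xs

  module _ {A : Set a} (S : DecSetoid b ℓ) where
    open DecSetoid S using (setoid; _≈_; _≟_) renaming (Carrier to B)
    open import Data.List.Membership.Setoid setoid using (_∈_)

    length≤fibre-bound*length : (f : A → B) {g : ℕ} (T : List B) (L : List A) →
                                All (λ x → f x ∈ T) L → (∀ y → length (filter (λ x → f x ≟ y) L) ≤ g) →
                                length L ≤ g * length T
    length≤fibre-bound*length f     []      []      _        _       = z≤n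
    length≤fibre-bound*length f     []      (x ∷ L) (() ∷ _) _
    length≤fibre-bound*length f {g} (t ∷ T) L       f[L]⊆t∷T fibre≤g = begin
      length L                                        ≡⟨ length-filter+length-filter-∁ over-t L ⟨
      length (filter over-t L) + length off-t         ≤⟨ ℕ.+-mono-≤ (fibre≤g t) off-t-bound ⟩
      g + g * length T                                ≡⟨ ℕ.*-suc g (length T) ⟨
      g * suc (length T)                              ∎
      where
      open ℕ.≤-Reasoning
      over-t : U.Decidable (λ x → f x ≈ t)
      over-t x = f x ≟ t
      off-t : List A
      off-t = filter (∁? over-t) L
      f[off-t]⊆T : All (λ x → f x ∈ T) off-t
      f[off-t]⊆T = All.zipWith (λ { (here ft≈t , ft≉t) → contradiction ft≈t ft≉t
                                  ; (there ft∈T , _)    → ft∈T })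
                               (All-filter⁺ (∁? over-t) f[L]⊆t∷T , all-filter (∁? over-t) L)
      off-t-bound : length off-t ≤ g * length T
      off-t-bound = length≤fibre-bound*length f T off-t f[off-t]⊆T
                      (λ y → ℕ.≤-trans (length-filter-filter≤ (∁? over-t) (λ x → f x ≟ y) L) (fibre≤g y))

module FieldTheory {c ℓ} (F : CommutativeRing c ℓ) (isField : FieldNotions.IsField F) where

  open import Level using (_⊔_)
  open import Data.Nat as ℕ using (ℕ; zero; suc; NonZero; NonTrivial; _∸_; _≤_; z≤n; s≤s; ≢-nonZero;
    ≢-nonZero⁻¹; nonTrivial⇒nonZero)
  import Data.Nat.Properties as ℕ
  open import Data.Nat.DivMod using (_/_; m/n*n≡m)
  open import Data.Nat.Divisibility using (_∣_; ∣-trans; divides; quotient; m∣n⇒n≡quotient*m)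
  open import Data.Nat.GCD using (gcd; module Bézout; gcd[m,n]∣m; gcd[m,n]∣n)
  open import Data.Nat.Coprimality using (Coprime; coprime-Bézout; coprime-/gcd)
  open import Data.Fin as Fin using (Fin)
  open import Data.Fin.Properties using (all?)
  open import Data.List using (List; []; _∷_; length; filter; map; foldr; tabulate)
  import Data.List.Properties as List
  open import Data.List.Relation.Unary.All as All using (All; []; _∷_)
  open import Data.List.Relation.Unary.All.Properties using (all-filter)
    renaming (filter⁺ to All-filter⁺)
  import Data.List.Relation.Unary.Any as Any
  import Data.List.Relation.Unary.Unique.Setoid.Properties as Unique
  open import Data.List.Membership.Setoid.Properties
    using (∈-filter⁺; ∈-filter⁻; ∈-map⁺; ∈-map⁻; ∈-resp-≈)
  open import Data.Maybe using (nothing)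
  open import Data.Product as Product using (∃; _×_; _,_; proj₁; proj₂)
  open import Function using (_∘_)
  open import Relation.Binary using (Decidable; DecSetoid)
  open import Relation.Binary.PropositionalEquality as ≡ using (_≡_)
  open import Relation.Nullary using (¬_; contradiction; ¬?; _×-dec_)
  import Relation.Unary as U
  open import Relation.Unary using (_≐_)
  open import Relation.Unary.Properties using (∁?)
  open import Tactic.RingSolver.Core.AlmostCommutativeRing
    using (AlmostCommutativeRing; fromCommutativeRing)

  open Arithmetic
  open ListCounting
  open CommutativeRing F hiding (zero)
  open FieldNotions F
    using (pow; norm; IsEnumeration; InUnitsOfSubfield; IsSolution; isSolution?; countSolutions)
  open import Algebra.Properties.CommutativeSemiring.Exp commutativeSemiring
    using (_^_; ^-congˡ; ^-congʳ; ^-assocʳ; ^-distrib-*)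
  open import Algebra.Properties.CommutativeSemigroup *-commutativeSemigroup using (interchange)
  open import Algebra.Properties.Group +-group using (x∙y⁻¹≈ε⇒x≈y)
  open import Relation.Binary.Reasoning.Setoid setoid
  open import Data.List.Relation.Unary.Unique.Setoid setoid using (Unique; []; _∷_)

  almostCommutativeRing : AlmostCommutativeRing c ℓ
  almostCommutativeRing = fromCommutativeRing F (λ _ → nothing)

  open import Tactic.RingSolver.NonReflective almostCommutativeRing using (solve; _⊜_; _⊕_; _⊗_)

  pow≡^ : ∀ x n → pow x n ≡ x ^ n
  pow≡^ x zero    = ≡.refl
  pow≡^ x (suc n) = ≡.cong (x *_) (pow≡^ x n)

  1^n≈1 : ∀ n → 1# ^ n ≈ 1#
  1^n≈1 zero    = refl
  1^n≈1 (suc n) = trans (*-identityˡ _) (1^n≈1 n)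

  1≉0 : ¬ 1# ≈ 0#
  1≉0 1≈0 = proj₁ isField (sym 1≈0)

  x*y≈0⇒y≈0 : ∀ {x y} → ¬ x ≈ 0# → x * y ≈ 0# → y ≈ 0#
  x*y≈0⇒y≈0 {x} {y} x≉0 xy≈0 with proj₂ isField x x≉0
  ... | x⁻¹ , xx⁻¹≈1 = begin
    y               ≈⟨ *-identityˡ y ⟨
    1# * y          ≈⟨ *-congʳ (trans (sym xx⁻¹≈1) (*-comm x x⁻¹)) ⟩
    (x⁻¹ * x) * y   ≈⟨ *-assoc x⁻¹ x y ⟩
    x⁻¹ * (x * y)   ≈⟨ *-congˡ xy≈0 ⟩
    x⁻¹ * 0#        ≈⟨ zeroʳ x⁻¹ ⟩
    0#              ∎

  x≉0∧y≉0⇒x*y≉0 : ∀ {x y} → ¬ x ≈ 0# → ¬ y ≈ 0# → ¬ x * y ≈ 0#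
  x≉0∧y≉0⇒x*y≉0 x≉0 y≉0 xy≈0 = y≉0 (x*y≈0⇒y≈0 x≉0 xy≈0)

  x^n≉0 : ∀ {x} n → ¬ x ≈ 0# → ¬ x ^ n ≈ 0#
  x^n≉0 zero    x≉0 = 1≉0
  x^n≉0 (suc n) x≉0 = x≉0∧y≉0⇒x*y≉0 x≉0 (x^n≉0 n x≉0)

  x≈0⇒x^n≈0 : ∀ {x} n .{{_ : NonZero n}} → x ≈ 0# → x ^ n ≈ 0#
  x≈0⇒x^n≈0 (suc n) x≈0 = trans (*-congʳ x≈0) (zeroˡ _)

  x*z≈y*z⇒[x-y]*z≈0 : ∀ {x y z} → x * z ≈ y * z → (x - y) * z ≈ 0#
  x*z≈y*z⇒[x-y]*z≈0 {x} {y} {z} xz≈yz = begin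
    (x - y) * z       ≈⟨ distribʳ z x (- y) ⟩
    x * z + - y * z   ≈⟨ +-cong xz≈yz (sym (-‿distribˡ-* y z)) ⟩
    y * z - y * z     ≈⟨ -‿inverseʳ (y * z) ⟩
    0#                ∎
    where open import Algebra.Properties.Ring ring using (-‿distribˡ-*)

  *-cancelʳ-≉0 : ∀ {x y z} → ¬ z ≈ 0# → x * z ≈ y * z → x ≈ y
  *-cancelʳ-≉0 z≉0 xz≈yz =
    x∙y⁻¹≈ε⇒x≈y _ _ (x*y≈0⇒y≈0 z≉0 (trans (*-comm _ _) (x*z≈y*z⇒[x-y]*z≈0 xz≈yz)))

  x*z≈y*z∧x≉y⇒z≈0 : ∀ {x y z} → ¬ x ≈ y → x * z ≈ y * z → z ≈ 0#
  x*z≈y*z∧x≉y⇒z≈0 x≉y xz≈yz =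
    x*y≈0⇒y≈0 (x≉y ∘ x∙y⁻¹≈ε⇒x≈y _ _) (x*z≈y*z⇒[x-y]*z≈0 xz≈yz)

  ^-suc≈⇒^≈1 : ∀ {a} n → ¬ a ≈ 0# → a ^ suc n ≈ a → a ^ n ≈ 1#
  ^-suc≈⇒^≈1 {a} n a≉0 a^suc≈a = *-cancelʳ-≉0 a≉0 (begin
    a ^ n * a   ≈⟨ *-comm (a ^ n) a ⟩
    a ^ suc n   ≈⟨ a^suc≈a ⟩
    a           ≈⟨ *-identityˡ a ⟨
    1# * a      ∎)

  InUnitsOfSubfield⇒^≈1 : ∀ {q d a} .{{_ : NonZero q}} → InUnitsOfSubfield q d a →
                          a ^ (q ℕ.^ d ∸ 1) ≈ 1#
  InUnitsOfSubfield⇒^≈1 {q} {d} {a} (a^q^d≈a , a≉0) = ^-suc≈⇒^≈1 (q ℕ.^ d ∸ 1) a≉0 (begin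
    a ^ ℕ.suc (q ℕ.^ d ∸ 1)   ≡⟨ ≡.cong (a ^_) (ℕ.suc-pred (q ℕ.^ d) {{ℕ.m^n≢0 q d}}) ⟩
    a ^ (q ℕ.^ d)             ≡⟨ pow≡^ a (q ℕ.^ d) ⟨
    pow a (q ℕ.^ d)           ≈⟨ a^q^d≈a ⟩
    a                         ∎)

  -- Roots of polynomials

  data Monic : ℕ → (Carrier → Carrier) → Set (c ⊔ ℓ) where
    one    : ∀ {f} → (∀ x → f x ≈ 1#) → Monic 0 f
    horner : ∀ {m f g} a → Monic m g → (∀ x → f x ≈ a + x * g x) → Monic (suc m) f

  Monic-+-* : ∀ {m g h} → Monic (suc m) g → Monic m h → ∀ r → Monic (suc m) (λ x → g x + r * h x)
  Monic-+-* {g = g} {h} (horner {g = g′} a g′-monic g≈) (one h≈1) r = horner (a + r) g′-monic λ x → begin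
    g x + r * h x        ≈⟨ +-cong (g≈ x) (trans (*-congˡ (h≈1 x)) (*-identityʳ r)) ⟩
    (a + x * g′ x) + r   ≈⟨ regroup a r x (g′ x) ⟩
    (a + r) + x * g′ x   ∎
    where
    regroup : ∀ a r x G → (a + x * G) + r ≈ (a + r) + x * G
    regroup = solve 4 (λ a r x G → ((a ⊕ x ⊗ G) ⊕ r) ⊜ ((a ⊕ r) ⊕ x ⊗ G)) refl
  Monic-+-* (horner {g = g′} a g′-monic g≈) (horner {g = h′} b h′-monic h≈) r =
    horner (a + r * b) (Monic-+-* g′-monic h′-monic r) λ x →
      trans (+-cong (g≈ x) (*-congˡ (h≈ x))) (regroup a b r x (g′ x) (h′ x))
    where
    regroup : ∀ a b r x G H → (a + x * G) + r * (b + x * H) ≈ (a + r * b) + x * (G + r * H)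
    regroup = solve 6 (λ a b r x G H →
      ((a ⊕ x ⊗ G) ⊕ r ⊗ (b ⊕ x ⊗ H)) ⊜ ((a ⊕ r ⊗ b) ⊕ x ⊗ (G ⊕ r ⊗ H))) refl

  -- f x − f r = (x − r) g x, kept free of subtraction: the solver has no zero test to cancel with.
  factor-theorem : ∀ {m f} → Monic (suc m) f → ∀ r →
                   ∃ λ g → Monic m g × (∀ x → f x + r * g x ≈ f r + x * g x)
  factor-theorem {f = f} (horner a (one g≈1) f≈) r = (λ _ → 1#) , one (λ _ → refl) , λ x → begin
    f x + r * 1#     ≈⟨ +-cong (f≈a+ x) (*-identityʳ r) ⟩
    (a + x) + r      ≈⟨ regroup a x r ⟩
    (a + r) + x      ≈⟨ +-cong (f≈a+ r) (*-identityʳ x) ⟨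
    f r + x * 1#     ∎
    where
    f≈a+ : ∀ x → f x ≈ a + x
    f≈a+ x = trans (f≈ x) (+-congˡ (trans (*-congˡ (g≈1 x)) (*-identityʳ x)))
    regroup : ∀ a x r → (a + x) + r ≈ (a + r) + x
    regroup = solve 3 (λ a x r → ((a ⊕ x) ⊕ r) ⊜ ((a ⊕ r) ⊕ x)) refl
  factor-theorem {f = f} (horner {g = g} a mg@(horner _ _ _) f≈) r with factor-theorem mg r
  ... | q , mq , g≈ = (λ x → g x + r * q x) , Monic-+-* mg mq r , λ x → begin
    f x + r * (g x + r * q x)            ≈⟨ +-cong (f≈ x) (*-congˡ (g≈ x)) ⟩
    (a + x * g x) + r * (g r + x * q x)  ≈⟨ regroup a x r (g x) (g r) (q x) ⟩
    (a + r * g r) + x * (g x + r * q x)  ≈⟨ +-congʳ (f≈ r) ⟨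
    f r + x * (g x + r * q x)            ∎
    where
    regroup : ∀ a x r gx gr qx → (a + x * gx) + r * (gr + x * qx) ≈ (a + r * gr) + x * (gx + r * qx)
    regroup = solve 6 (λ a x r gx gr qx →
      ((a ⊕ x ⊗ gx) ⊕ r ⊗ (gr ⊕ x ⊗ qx)) ⊜ ((a ⊕ r ⊗ gr) ⊕ x ⊗ (gx ⊕ r ⊗ qx))) refl

  monic-roots≤ : ∀ {m f L} → Monic m f → Unique L → All (λ x → f x ≈ 0#) L → length L ≤ m
  monic-roots≤ _         []       []         = z≤n
  monic-roots≤ (one f≈1) _        (fr≈0 ∷ _) = contradiction (trans (sym (f≈1 _)) fr≈0) 1≉0
  monic-roots≤ {f = f} {r ∷ L} f-monic@(horner _ _ _) (r≉L ∷ L-unique) (fr≈0 ∷ fL≈0)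
    with factor-theorem f-monic r
  ... | g , g-monic , f≈ =
    s≤s (monic-roots≤ g-monic L-unique (All.zipWith (λ (r≉x , fx≈0) → g-root r≉x fx≈0) (r≉L , fL≈0)))
    where
    g-root : ∀ {x} → ¬ r ≈ x → f x ≈ 0# → g x ≈ 0#
    g-root {x} r≉x fx≈0 = x*z≈y*z∧x≉y⇒z≈0 r≉x (begin
      r * g x          ≈⟨ +-identityˡ _ ⟨
      0# + r * g x     ≈⟨ +-congʳ fx≈0 ⟨
      f x + r * g x    ≈⟨ f≈ x ⟩
      f r + x * g x    ≈⟨ +-congʳ fr≈0 ⟩
      0# + x * g x     ≈⟨ +-identityˡ _ ⟩
      x * g x          ∎)

  Monic-^ : ∀ m → Monic m (_^ m)
  Monic-^ zero    = one (λ _ → refl)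
  Monic-^ (suc m) = horner 0# (Monic-^ m) (λ _ → sym (+-identityˡ _))

  ^-roots≤ : ∀ m .{{_ : NonZero m}} {b L} → Unique L → All (λ x → x ^ m ≈ b) L → length L ≤ m
  ^-roots≤ (suc m) {b} L-unique roots =
    monic-roots≤ (horner (- b) (Monic-^ m) (λ _ → +-comm _ _)) L-unique
                 (All.map (λ x^m≈b → trans (+-congʳ x^m≈b) (-‿inverseʳ b)) roots)

  -- Systems of binomial equations

  ^-≈-* : ∀ {x y m n} → x ^ m ≈ y ^ n → ∀ k → x ^ (k ℕ.* m) ≈ y ^ (k ℕ.* n)
  ^-≈-* {x} {y} {m} {n} x^m≈y^n k = begin
    x ^ (k ℕ.* m)   ≡⟨ ≡.cong (x ^_) (ℕ.*-comm k m) ⟩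
    x ^ (m ℕ.* k)   ≈⟨ ^-assocʳ x m k ⟨
    (x ^ m) ^ k     ≈⟨ ^-congˡ k x^m≈y^n ⟩
    (y ^ n) ^ k     ≈⟨ ^-assocʳ y n k ⟩
    y ^ (n ℕ.* k)   ≡⟨ ≡.cong (y ^_) (ℕ.*-comm n k) ⟩
    y ^ (k ℕ.* n)   ∎

  ^-^-comm : ∀ x m n → (x ^ m) ^ n ≈ (x ^ n) ^ m
  ^-^-comm x m n = trans (^-assocʳ x m n) (trans (^-congʳ x (ℕ.*-comm m n)) (sym (^-assocʳ x n m)))

  private
    ^-injective-Bézout : ∀ {β γ m n} u v → 1 ℕ.+ v ℕ.* n ≡ u ℕ.* m → ¬ γ ≈ 0# →
                         β ^ m ≈ γ ^ m → β ^ n ≈ γ ^ n → β ≈ γ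
    ^-injective-Bézout {β} {γ} {m} {n} u v bézout γ≉0 β^m≈γ^m β^n≈γ^n =
      *-cancelʳ-≉0 (x^n≉0 (v ℕ.* n) γ≉0) (begin
        β * γ ^ (v ℕ.* n)   ≈⟨ *-congˡ (^-≈-* β^n≈γ^n v) ⟨
        β ^ suc (v ℕ.* n)   ≡⟨ ≡.cong (β ^_) bézout ⟩
        β ^ (u ℕ.* m)       ≈⟨ ^-≈-* β^m≈γ^m u ⟩
        γ ^ (u ℕ.* m)       ≡⟨ ≡.cong (γ ^_) bézout ⟨
        γ * γ ^ (v ℕ.* n)   ∎)

    -- The root is a ^ u / b ^ v, where 1 + v n = u m.
    common-root-Bézout : ∀ {a b m n} u v → 1 ℕ.+ v ℕ.* n ≡ u ℕ.* m → ¬ b ≈ 0# →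
                         a ^ n ≈ b ^ m → ∃ λ γ → γ ^ m ≈ a × γ ^ n ≈ b
    common-root-Bézout {a} {b} {m} {n} u v bézout b≉0 a^n≈b^m
      with proj₂ isField (b ^ v) (x^n≉0 v b≉0)
    ... | B⁻¹ , b^vB⁻¹≈1 = γ , γ^m≈a , γ^n≈b
      where
      γ : Carrier
      γ = a ^ u * B⁻¹
      γb^v≈a^u : γ * b ^ v ≈ a ^ u
      γb^v≈a^u = begin
        a ^ u * B⁻¹ * b ^ v     ≈⟨ *-assoc (a ^ u) B⁻¹ (b ^ v) ⟩
        a ^ u * (B⁻¹ * b ^ v)   ≈⟨ *-congˡ (trans (*-comm B⁻¹ (b ^ v)) b^vB⁻¹≈1) ⟩
        a ^ u * 1#              ≈⟨ *-identityʳ (a ^ u) ⟩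
        a ^ u                   ∎
      γ^k*b^vk≈a^uk : ∀ k → γ ^ k * b ^ (v ℕ.* k) ≈ a ^ (u ℕ.* k)
      γ^k*b^vk≈a^uk k = begin
        γ ^ k * b ^ (v ℕ.* k)     ≈⟨ *-congˡ (^-assocʳ b v k) ⟨
        γ ^ k * (b ^ v) ^ k       ≈⟨ ^-distrib-* γ (b ^ v) k ⟨
        (γ * b ^ v) ^ k           ≈⟨ ^-congˡ k γb^v≈a^u ⟩
        (a ^ u) ^ k               ≈⟨ ^-assocʳ a u k ⟩
        a ^ (u ℕ.* k)             ∎
      γ^m≈a : γ ^ m ≈ a
      γ^m≈a = *-cancelʳ-≉0 (x^n≉0 (v ℕ.* m) b≉0) (begin
        γ ^ m * b ^ (v ℕ.* m)     ≈⟨ γ^k*b^vk≈a^uk m ⟩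
        a ^ (u ℕ.* m)             ≡⟨ ≡.cong (a ^_) bézout ⟨
        a * a ^ (v ℕ.* n)         ≈⟨ *-congˡ (^-≈-* a^n≈b^m v) ⟩
        a * b ^ (v ℕ.* m)         ∎)
      γ^n≈b : γ ^ n ≈ b
      γ^n≈b = *-cancelʳ-≉0 (x^n≉0 (v ℕ.* n) b≉0) (begin
        γ ^ n * b ^ (v ℕ.* n)     ≈⟨ γ^k*b^vk≈a^uk n ⟩
        a ^ (u ℕ.* n)             ≈⟨ ^-≈-* a^n≈b^m u ⟩
        b ^ (u ℕ.* m)             ≡⟨ ≡.cong (b ^_) bézout ⟨
        b * b ^ (v ℕ.* n)         ∎)

  ^-injective-coprime : ∀ {β γ m n} → Coprime m n → ¬ γ ≈ 0# →
                        β ^ m ≈ γ ^ m → β ^ n ≈ γ ^ n → β ≈ γ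
  ^-injective-coprime {m = m} {n} m⊥n γ≉0 β^m≈γ^m β^n≈γ^n with coprime-Bézout m⊥n
  ... | Bézout.+- u v bézout = ^-injective-Bézout {m = m} {n} u v bézout γ≉0 β^m≈γ^m β^n≈γ^n
  ... | Bézout.-+ u v bézout = ^-injective-Bézout {m = n} {m} v u bézout γ≉0 β^n≈γ^n β^m≈γ^m

  coprime-common-root : ∀ {a b m n} → Coprime m n → ¬ a ≈ 0# → ¬ b ≈ 0# → a ^ n ≈ b ^ m →
                        ∃ λ γ → γ ^ m ≈ a × γ ^ n ≈ b
  coprime-common-root {m = m} {n} m⊥n a≉0 b≉0 a^n≈b^m with coprime-Bézout m⊥n
  ... | Bézout.+- u v bézout = common-root-Bézout {m = m} {n} u v bézout b≉0 a^n≈b^m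
  ... | Bézout.-+ u v bézout with common-root-Bézout {m = n} {m} v u bézout a≉0 (sym a^n≈b^m)
  ...   | γ , γ^n≈b , γ^m≈a = γ , γ^m≈a , γ^n≈b

  -- If α ^ e ≈ a and α ^ e' ≈ b, then e x ≡ e' y forces a ^ x ≈ α ^ (e x) ≈ b ^ y.
  Compatible : ℕ → Carrier → ℕ → Carrier → Set ℓ
  Compatible e a e' b = ∀ x y → e ℕ.* x ≡ e' ℕ.* y → a ^ x ≈ b ^ y

  -- The field compatible is what allows reductions to be iterated.
  record Reduction {s t} (Solves : Carrier → Set s) (Constraint : ℕ → Carrier → Set t) (h : ℕ)
                   : Set (c ⊔ ℓ ⊔ s ⊔ t) where
    field
      value      : Carrier
      value≉0    : ¬ value ≈ 0#
      sound      : ∀ {α} → α ^ h ≈ value → Solves α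
      complete   : ∀ {α} → Solves α → α ^ h ≈ value
      compatible : ∀ {E A} .{{_ : NonZero E}} → Constraint E A → Compatible E A h value

  merge : ∀ {e e' a b} .{{_ : NonZero e}} → ¬ a ≈ 0# → ¬ b ≈ 0# → Compatible e a e' b →
          Reduction (λ α → α ^ e ≈ a × α ^ e' ≈ b)
                    (λ E A → Compatible E A e a × Compatible E A e' b)
                    (gcd e e')
  merge {e} {e'} {a} {b} a≉0 b≉0 compat = record
    { value      = γ
    ; value≉0    = γ≉0
    ; sound      = λ α^g≈γ → lift m e≡g*m γ^m≈a α^g≈γ , lift n e'≡g*n γ^n≈b α^g≈γ
    ; complete   = λ (α^e≈a , α^e'≈b) → ^-injective-coprime m⊥n γ≉0
                     (descend m e≡g*m α^e≈a γ^m≈a) (descend n e'≡g*n α^e'≈b γ^n≈b)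
    ; compatible = λ {E} {A} (E-a , E-b) x y Ex≡gy → ^-injective-coprime m⊥n (x^n≉0 y γ≉0)
                     (transfer {E} m x y E-a e≡g*m γ^m≈a Ex≡gy) (transfer {E} n x y E-b e'≡g*n γ^n≈b Ex≡gy)
    }
    where
    g : ℕ
    g = gcd e e'
    instance
      g≢0 : NonZero g
      g≢0 = gcd≢0ˡ e e'
    m n : ℕ
    m = e / g
    n = e' / g
    m⊥n : Coprime m n
    m⊥n = coprime-/gcd e e'
    e≡g*m : e ≡ g ℕ.* m
    e≡g*m = ≡.trans (≡.sym (m/n*n≡m (gcd[m,n]∣m e e'))) (ℕ.*-comm m g)
    e'≡g*n : e' ≡ g ℕ.* n
    e'≡g*n = ≡.trans (≡.sym (m/n*n≡m (gcd[m,n]∣n e e'))) (ℕ.*-comm n g)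
    instance
      m≢0 : NonZero m
      m≢0 = ≢-nonZero λ m≡0 →
        ≢-nonZero⁻¹ e (≡.trans e≡g*m (≡.trans (≡.cong (g ℕ.*_) m≡0) (ℕ.*-zeroʳ g)))
    a^n≈b^m : a ^ n ≈ b ^ m
    a^n≈b^m = compat n m (cross-multiply {g = g} {m} {n} e≡g*m e'≡g*n)
    common-root : ∃ λ γ → γ ^ m ≈ a × γ ^ n ≈ b
    common-root = coprime-common-root m⊥n a≉0 b≉0 a^n≈b^m
    γ : Carrier
    γ = proj₁ common-root
    γ^m≈a : γ ^ m ≈ a
    γ^m≈a = proj₁ (proj₂ common-root)
    γ^n≈b : γ ^ n ≈ b
    γ^n≈b = proj₂ (proj₂ common-root)
    γ≉0 : ¬ γ ≈ 0#
    γ≉0 γ≈0 = a≉0 (trans (sym γ^m≈a) (x≈0⇒x^n≈0 m γ≈0))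
    lift : ∀ {α d c} k → d ≡ g ℕ.* k → γ ^ k ≈ c → α ^ g ≈ γ → α ^ d ≈ c
    lift {α} {d} {c} k d≡gk γ^k≈c α^g≈γ = begin
      α ^ d          ≡⟨ ≡.cong (α ^_) d≡gk ⟩
      α ^ (g ℕ.* k)  ≈⟨ ^-assocʳ α g k ⟨
      (α ^ g) ^ k    ≈⟨ ^-congˡ k α^g≈γ ⟩
      γ ^ k          ≈⟨ γ^k≈c ⟩
      c              ∎
    descend : ∀ {β d c} k → d ≡ g ℕ.* k → β ^ d ≈ c → γ ^ k ≈ c → (β ^ g) ^ k ≈ γ ^ k
    descend {β} {d} {c} k d≡gk β^d≈c γ^k≈c = begin
      (β ^ g) ^ k    ≈⟨ ^-assocʳ β g k ⟩
      β ^ (g ℕ.* k)  ≡⟨ ≡.cong (β ^_) d≡gk ⟨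
      β ^ d          ≈⟨ β^d≈c ⟩
      c              ≈⟨ γ^k≈c ⟨
      γ ^ k          ∎
    transfer : ∀ {E A d c} k x y → Compatible E A d c → d ≡ g ℕ.* k → γ ^ k ≈ c →
               E ℕ.* x ≡ g ℕ.* y → (A ^ x) ^ k ≈ (γ ^ y) ^ k
    transfer {E} {A} {d} {c} k x y E-c d≡gk γ^k≈c Ex≡gy = begin
      (A ^ x) ^ k      ≈⟨ ^-assocʳ A x k ⟩
      A ^ (x ℕ.* k)    ≈⟨ E-c (x ℕ.* k) y (rescale {E} {x} {g} {y} {k = k} Ex≡gy d≡gk) ⟩
      c ^ y            ≈⟨ ^-congˡ y γ^k≈c ⟨
      (γ ^ k) ^ y      ≈⟨ ^-^-comm γ k y ⟩
      (γ ^ y) ^ k      ∎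

  Solves : ∀ {k} → (Fin k → ℕ) → (Fin k → Carrier) → Carrier → Set ℓ
  Solves e a α = ∀ i → α ^ e i ≈ a i

  Solution : ∀ {k} → (Fin k → ℕ) → (Fin k → Carrier) → Carrier → Set ℓ
  Solution e a α = ¬ α ≈ 0# × Solves e a α

  IsSolution≐Solution : ∀ q n k d a →
                        IsSolution q n k d a ≐ Solution (λ i → (q ℕ.^ n ∸ 1) div (q ℕ.^ d i ∸ 1)) a
  IsSolution≐Solution q n k d a =
    (λ {α} (α≉0 , norms≈a) → α≉0 , λ i → trans (reflexive (≡.sym (pow≡^ α (e i)))) (norms≈a i)) ,
    (λ {α} (α≉0 , α^e≈a)   → α≉0 , λ i → trans (reflexive (pow≡^ α (e i))) (α^e≈a i))
    where
    e : Fin k → ℕ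
    e i = (q ℕ.^ n ∸ 1) div (q ℕ.^ d i ∸ 1)

  CompatibleWith : ∀ {k} → (Fin k → ℕ) → (Fin k → Carrier) → ℕ → Carrier → Set ℓ
  CompatibleWith e a E A = ∀ i → Compatible E A (e i) (a i)

  reduce : ∀ {k} (e : Fin k → ℕ) (a : Fin k → Carrier) → (∀ i → NonZero (e i)) →
           (∀ i → ¬ a i ≈ 0#) → (∀ i j → Compatible (e i) (a i) (e j) (a j)) →
           Reduction (Solves e a) (CompatibleWith e a) (foldr gcd 0 (tabulate e))
  reduce {ℕ.zero} e a _ _ _ = record
    { value      = 1#
    ; value≉0    = 1≉0
    ; sound      = λ _ ()
    ; complete   = λ _ → refl
    ; compatible = λ {E} {A} _ x y Ex≡0 →
        trans (^-congʳ A (ℕ.m*n≡0⇒m≡0 x E (≡.trans (ℕ.*-comm x E) Ex≡0))) (sym (1^n≈1 y))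
    }
  reduce {ℕ.suc k} e a e≢0 a≉0 compat = record
    { value      = value
    ; value≉0    = value≉0
    ; sound      = λ α^h≈v → λ { Fin.zero    → proj₁ (sound α^h≈v)
                              ; (Fin.suc i) → Reduction.sound rest (proj₂ (sound α^h≈v)) i }
    ; complete   = λ solves → complete (solves Fin.zero , Reduction.complete rest (solves ∘ Fin.suc))
    ; compatible = λ E-a → compatible (E-a Fin.zero , Reduction.compatible rest (E-a ∘ Fin.suc))
    }
    where
    instance
      e₀≢0 : NonZero (e Fin.zero)
      e₀≢0 = e≢0 Fin.zero
    h′ : ℕ
    h′ = foldr gcd 0 (tabulate (e ∘ Fin.suc))
    rest : Reduction (Solves (e ∘ Fin.suc) (a ∘ Fin.suc)) (CompatibleWith (e ∘ Fin.suc) (a ∘ Fin.suc)) h′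
    rest = reduce (e ∘ Fin.suc) (a ∘ Fin.suc) (e≢0 ∘ Fin.suc) (a≉0 ∘ Fin.suc)
                  (λ i j → compat (Fin.suc i) (Fin.suc j))
    open Reduction (merge {e' = h′} (a≉0 Fin.zero) (Reduction.value≉0 rest)
                          (Reduction.compatible rest (compat Fin.zero ∘ Fin.suc)))

  compatible-of-norms : ∀ {e e' m n a b} .{{_ : NonZero e}} .{{_ : NonZero m}} → e ℕ.* m ≡ e' ℕ.* n →
                        a ^ (m div gcd m n) ≈ b ^ (n div gcd m n) → Compatible e a e' b
  compatible-of-norms {e} {e'} {m} {n} {a} {b} em≡e'n a^r≈b^s x y ex≡e'y
    with proportional⇒multiples m n {x} {y}
           (ℕ.*-cancelˡ-≡ (x ℕ.* n) (y ℕ.* m) e (*-proportion {e} {e'} {m} {n} {x} {y} em≡e'n ex≡e'y))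
  ... | t , x≡rt , y≡st = begin
    a ^ x                        ≡⟨ ≡.cong (a ^_) x≡rt ⟩
    a ^ (m div gcd m n ℕ.* t)    ≈⟨ ^-assocʳ a (m div gcd m n) t ⟨
    (a ^ (m div gcd m n)) ^ t    ≈⟨ ^-congˡ t a^r≈b^s ⟩
    (b ^ (n div gcd m n)) ^ t    ≈⟨ ^-assocʳ b (n div gcd m n) t ⟩
    b ^ (n div gcd m n ℕ.* t)    ≡⟨ ≡.cong (b ^_) y≡st ⟨
    b ^ y                        ∎

  compatible-with-1 : ∀ {e m N a} .{{_ : NonZero e}} → e ℕ.* m ≡ N → a ^ m ≈ 1# → Compatible N 1# e a
  compatible-with-1 {e} {m} {N} {a} em≡N a^m≈1 x y Nx≡ey = begin
    1# ^ x               ≈⟨ ^-congˡ x a^m≈1 ⟨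
    (a ^ m) ^ x          ≈⟨ ^-assocʳ a m x ⟩
    a ^ (m ℕ.* x)        ≡⟨ ≡.cong (a ^_) (ℕ.*-cancelˡ-≡ (m ℕ.* x) y e emx≡ey) ⟩
    a ^ y                ∎
    where
    emx≡ey : e ℕ.* (m ℕ.* x) ≡ e ℕ.* y
    emx≡ey = ≡.trans (≡.sym (ℕ.*-assoc e m x)) (≡.trans (≡.cong (ℕ._* x) em≡N) Nx≡ey)

  module Finite (_≈?_ : Decidable _≈_) (xs : List Carrier) (enumerates : IsEnumeration xs) where
    open import Data.List.Membership.Setoid setoid using (_∈_)
    open import Data.List.Relation.Binary.Permutation.Setoid setoid using (_↭_)
    open import Data.List.Relation.Binary.Permutation.Setoid.Properties setoid using (foldr-commMonoid)

    decSetoid : DecSetoid c ℓ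
    decSetoid = record { isDecEquivalence = record { isEquivalence = isEquivalence ; _≟_ = _≈?_ } }

    ≉0-resp-≈ : ∀ {x y} → x ≈ y → ¬ x ≈ 0# → ¬ y ≈ 0#
    ≉0-resp-≈ x≈y x≉0 y≈0 = x≉0 (trans x≈y y≈0)

    units : List Carrier
    units = filter (∁? (_≈? 0#)) xs

    units-unique : Unique units
    units-unique = Unique.filter⁺ setoid (∁? (_≈? 0#)) (proj₂ enumerates)

    ∈-units⁺ : ∀ {x} → ¬ x ≈ 0# → x ∈ units
    ∈-units⁺ {x} = ∈-filter⁺ setoid (∁? (_≈? 0#)) ≉0-resp-≈ (proj₁ enumerates x)

    units-≉0 : All (λ x → ¬ x ≈ 0#) units
    units-≉0 = all-filter (∁? (_≈? 0#)) xs

    ∈-units⁻ : ∀ {x} → x ∈ units → ¬ x ≈ 0#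
    ∈-units⁻ x∈units = proj₂ (∈-filter⁻ setoid (∁? (_≈? 0#)) ≉0-resp-≈ {xs = xs} x∈units)

    suc-length-units : suc (length units) ≡ length xs
    suc-length-units = ≡.trans (≡.cong (ℕ._+ length units) (ℕ.≤-antisym 1≤zeros zeros≤1))
                               (length-filter+length-filter-∁ (_≈? 0#) xs)
      where
      zeros : List Carrier
      zeros = filter (_≈? 0#) xs
      zeros≤1 : length zeros ≤ 1
      zeros≤1 = ^-roots≤ 1 (Unique.filter⁺ setoid (_≈? 0#) (proj₂ enumerates))
                           (All.map (trans (*-identityʳ _)) (all-filter (_≈? 0#) xs))
      1≤zeros : 1 ≤ length zeros
      1≤zeros = List.filter-some (_≈? 0#) (Any.map sym (proj₁ enumerates 0#))

    private
      product : List Carrier → Carrier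
      product = foldr _*_ 1#

      product-≉0 : ∀ {L} → All (λ x → ¬ x ≈ 0#) L → ¬ product L ≈ 0#
      product-≉0 []          = 1≉0
      product-≉0 (x≉0 ∷ L≉0) = x≉0∧y≉0⇒x*y≉0 x≉0 (product-≉0 L≉0)

      product-map-* : ∀ α L → product (map (α *_) L) ≈ α ^ length L * product L
      product-map-* α []      = sym (*-identityʳ 1#)
      product-map-* α (x ∷ L) = begin
        α * x * product (map (α *_) L)      ≈⟨ *-congˡ (product-map-* α L) ⟩
        α * x * (α ^ length L * product L)  ≈⟨ interchange α x (α ^ length L) (product L) ⟩
        α * α ^ length L * (x * product L)  ∎

    -- Multiplication by α permutes the units, so it leaves their product unchanged.
    ^-length-units≈1 : ∀ {α} → ¬ α ≈ 0# → α ^ length units ≈ 1#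
    ^-length-units≈1 {α} α≉0 = *-cancelʳ-≉0 (product-≉0 units-≉0) (begin
      α ^ length units * product units  ≈⟨ product-map-* α units ⟨
      product (map (α *_) units)        ≈⟨ foldr-commMonoid *-isCommutativeMonoid αunits↭units ⟩
      product units                     ≈⟨ *-identityˡ _ ⟨
      1# * product units                ∎)
      where
      α⁻¹ : Carrier
      α⁻¹ = proj₁ (proj₂ isField α α≉0)
      αα⁻¹≈1 : α * α⁻¹ ≈ 1#
      αα⁻¹≈1 = proj₂ (proj₂ isField α α≉0)
      α*-injective : ∀ {x y} → α * x ≈ α * y → x ≈ y
      α*-injective αx≈αy = *-cancelʳ-≉0 α≉0 (trans (*-comm _ α) (trans αx≈αy (*-comm α _)))
      αunits⊆units : ∀ {z} → z ∈ map (α *_) units → z ∈ units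
      αunits⊆units z∈ with ∈-map⁻ setoid setoid z∈
      ... | x , x∈units , z≈αx =
        ∈-units⁺ (≉0-resp-≈ (sym z≈αx) (x≉0∧y≉0⇒x*y≉0 α≉0 (∈-units⁻ x∈units)))
      units⊆αunits : ∀ {z} → z ∈ units → z ∈ map (α *_) units
      units⊆αunits {z} z∈units =
        ∈-resp-≈ setoid αα⁻¹z≈z (∈-map⁺ setoid setoid *-congˡ (∈-units⁺ α⁻¹z≉0))
        where
        αα⁻¹z≈z : α * (α⁻¹ * z) ≈ z
        αα⁻¹z≈z = trans (sym (*-assoc α α⁻¹ z)) (trans (*-congʳ αα⁻¹≈1) (*-identityˡ z))
        α⁻¹z≉0 : ¬ α⁻¹ * z ≈ 0#
        α⁻¹z≉0 α⁻¹z≈0 =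
          ∈-units⁻ z∈units (trans (sym αα⁻¹z≈z) (trans (*-congˡ α⁻¹z≈0) (zeroʳ α)))
      αunits↭units : map (α *_) units ↭ units
      αunits↭units = unique-⊆-⊇⇒↭ setoid (Unique.map⁺ setoid setoid α*-injective units-unique) units-unique
                                  αunits⊆units units⊆αunits

    -- Outside the fibre over b, x ↦ x ^ g maps the units into the other roots of y ^ M ≈ 1,
    -- of which there are fewer than M, with fibres of size at most g.
    ^-roots-units≥ : ∀ {g M b} .{{_ : NonZero g}} .{{_ : NonZero M}} → g ℕ.* M ≡ length units →
                     b ^ M ≈ 1# → g ≤ length (filter (λ x → (x ^ g) ≈? b) units)
    ^-roots-units≥ {g} {M} {b} gM≡N b^M≈1 = pigeonhole-≤ T<M
      (≡.trans gM≡N (≡.sym (length-filter+length-filter-∁ over-b units)))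
      (length≤fibre-bound*length decSetoid (_^ g) T off off⊆T fibre≤g)
      where
      Other : Carrier → Set ℓ
      Other y = y ^ M ≈ 1# × ¬ y ≈ b
      other? : U.Decidable Other
      other? y = ((y ^ M) ≈? 1#) ×-dec ¬? (y ≈? b)
      T : List Carrier
      T = filter other? xs
      T<M : ℕ.suc (length T) ≤ M
      T<M = ^-roots≤ M (All.map (λ (_ , y≉b) b≈y → y≉b (sym b≈y)) (all-filter other? xs)
                       ∷ Unique.filter⁺ setoid other? (proj₂ enumerates))
                      (b^M≈1 ∷ All.map proj₁ (all-filter other? xs))
      over-b : U.Decidable (λ x → x ^ g ≈ b)
      over-b x = (x ^ g) ≈? b
      off : List Carrier
      off = filter (∁? over-b) units
      Other-resp-≈ : ∀ {y z} → y ≈ z → Other y → Other z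
      Other-resp-≈ y≈z (y^M≈1 , y≉b) =
        trans (^-congˡ M (sym y≈z)) y^M≈1 , λ z≈b → y≉b (trans y≈z z≈b)
      off⊆T : All (λ x → x ^ g ∈ T) off
      off⊆T = All.zipWith (λ (x≉0 , x^g≉b) → ∈-filter⁺ setoid other? Other-resp-≈ (proj₁ enumerates _)
                              (trans (^-assocʳ _ g M) (trans (^-congʳ _ gM≡N) (^-length-units≈1 x≉0)) , x^g≉b))
                          (All-filter⁺ (∁? over-b) units-≉0 , all-filter (∁? over-b) units)
      fibre≤g : ∀ y → length (filter (λ x → (x ^ g) ≈? y) off) ≤ g
      fibre≤g y = ^-roots≤ g (Unique.filter⁺ setoid _ (Unique.filter⁺ setoid _ units-unique)) (all-filter _ off)

    ^-roots-count : ∀ {h M b} .{{_ : NonZero h}} .{{_ : NonZero M}} → h ℕ.* M ≡ length units →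
                    b ^ M ≈ 1# → length (filter (λ x → (x ^ h) ≈? b) xs) ≡ h
    ^-roots-count {h} {b = b} hM≡N b^M≈1 = ℕ.≤-antisym
      (^-roots≤ h (Unique.filter⁺ setoid _ (proj₂ enumerates)) (all-filter _ xs))
      (ℕ.≤-trans (^-roots-units≥ hM≡N b^M≈1)
                 (length-filter-filter≤ (∁? (_≈? 0#)) (λ x → (x ^ h) ≈? b) xs))

    solution? : ∀ {k} (e : Fin k → ℕ) (a : Fin k → Carrier) → U.Decidable (Solution e a)
    solution? e a α = ¬? (α ≈? 0#) ×-dec all? (λ i → (α ^ e i) ≈? a i)

    system-solutions : ∀ {k} (e m : Fin (ℕ.suc k) → ℕ) (a : Fin (ℕ.suc k) → Carrier) →
                       (∀ i → e i ℕ.* m i ≡ length units) → (∀ i → a i ^ m i ≈ 1#) →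
                       (∀ i j → a i ^ (m i div gcd (m i) (m j)) ≈ a j ^ (m j div gcd (m i) (m j))) →
                       ∃ (Solution e a) × length (filter (solution? e a) xs) ≡ foldr gcd 0 (tabulate e)
    system-solutions e m a em≡N a^m≈1 norms =
      length-filter>0⇒∃ (solution? e a) xs (≡.subst (0 ℕ.<_) (≡.sym count) (ℕ.>-nonZero⁻¹ h)) , count
      where
      instance
        N≢0 : NonZero (length units)
        N≢0 = ℕ.>-nonZero (List.filter-some (∁? (_≈? 0#))
                                            (Any.map (λ 1≈x → ≉0-resp-≈ 1≈x 1≉0) (proj₁ enumerates 1#)))
      e≢0 : ∀ i → NonZero (e i)
      e≢0 i = ℕ.m*n≢0⇒m≢0 (e i) {{≡.subst NonZero (≡.sym (em≡N i)) N≢0}}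
      m≢0 : ∀ i → NonZero (m i)
      m≢0 i = ℕ.m*n≢0⇒n≢0 (e i) {{≡.subst NonZero (≡.sym (em≡N i)) N≢0}}
      a≉0 : ∀ i → ¬ a i ≈ 0#
      a≉0 i a≈0 = 1≉0 (trans (sym (a^m≈1 i)) (x≈0⇒x^n≈0 (m i) {{m≢0 i}} a≈0))
      compat : ∀ i j → Compatible (e i) (a i) (e j) (a j)
      compat i j = compatible-of-norms {e' = e j} {{e≢0 i}} {{m≢0 i}} (≡.trans (em≡N i) (≡.sym (em≡N j)))
                                       (norms i j)
      open Reduction (reduce e a e≢0 a≉0 compat)
      h : ℕ
      h = foldr gcd 0 (tabulate e)
      instance
        e₀≢0 : NonZero (e Fin.zero)
        e₀≢0 = e≢0 Fin.zero
        h≢0 : NonZero h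
        h≢0 = gcd≢0ˡ (e Fin.zero) _
      h∣N : h ∣ length units
      h∣N = ∣-trans (gcd[m,n]∣m (e Fin.zero) (foldr gcd 0 (tabulate (e ∘ Fin.suc))))
                    (divides (m Fin.zero) (≡.trans (≡.sym (em≡N Fin.zero)) (ℕ.*-comm (e Fin.zero) (m Fin.zero))))
      M : ℕ
      M = quotient h∣N
      hM≡N : h ℕ.* M ≡ length units
      hM≡N = ≡.trans (ℕ.*-comm h M) (≡.sym (m∣n⇒n≡quotient*m h∣N))
      instance
        M≢0 : NonZero M
        M≢0 = ℕ.m*n≢0⇒n≢0 h {{≡.subst NonZero (≡.sym hM≡N) N≢0}}
      value^M≈1 : value ^ M ≈ 1#
      value^M≈1 = sym (trans (sym (*-identityʳ 1#))
        (compatible (λ i → compatible-with-1 {{e≢0 i}} (em≡N i) (a^m≈1 i)) 1 M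
                    (≡.trans (ℕ.*-identityʳ _) (≡.sym hM≡N))))
      count : length (filter (solution? e a) xs) ≡ h
      count = ≡.trans (≡.cong length (List.filter-≐ (solution? e a) (λ x → (x ^ h) ≈? value)
                                        ((complete ∘ proj₂) , λ α^h≈v → ≉0 α^h≈v , sound α^h≈v) xs))
                      (^-roots-count hM≡N value^M≈1)
        where
        ≉0 : ∀ {α} → α ^ h ≈ value → ¬ α ≈ 0#
        ≉0 α^h≈v α≈0 = value≉0 (trans (sym α^h≈v) (x≈0⇒x^n≈0 h α≈0))

    norm-equations : ∀ q .{{_ : NonTrivial q}} n .{{_ : NonZero n}} → length xs ≡ q ℕ.^ n →
                     ∀ {k} (d : Fin (ℕ.suc k) → ℕ) (a : Fin (ℕ.suc k) → Carrier) → (∀ i → d i ∣ n) →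
                     (∀ i → InUnitsOfSubfield q (d i) (a i)) →
                     (∀ i j → norm q (d i) (gcd (d i) (d j)) (a i) ≈ norm q (d j) (gcd (d i) (d j)) (a j)) →
                     ∃ (IsSolution q n (ℕ.suc k) d a) ×
                     countSolutions _≈?_ xs q n (ℕ.suc k) d a
                       ≡ foldr gcd 0 (tabulate (λ i → (q ℕ.^ n ∸ 1) div (q ℕ.^ d i ∸ 1)))
    norm-equations q n |xs|≡q^n {k} d a d∣n a∈F* norms-agree =
      Product.map (Product.map₂ (proj₂ solution≐)) (≡.trans (≡.cong length same-filter))
        (system-solutions e (Q ∘ d) a cofactor (λ i → InUnitsOfSubfield⇒^≈1 {q} {d i} (a∈F* i)) norms)
      where
      open PowerMinusOne q
      instance
        q≢0 : NonZero q
        q≢0 = nonTrivial⇒nonZero q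
      e : Fin (ℕ.suc k) → ℕ
      e i = Q n div Q (d i)
      solution≐ : IsSolution q n (ℕ.suc k) d a ≐ Solution e a
      solution≐ = IsSolution≐Solution q n (ℕ.suc k) d a
      same-filter : filter (isSolution? _≈?_ q n (ℕ.suc k) d a) xs ≡ filter (solution? e a) xs
      same-filter = List.filter-≐ (isSolution? _≈?_ q n (ℕ.suc k) d a) (solution? e a) solution≐ xs
      cofactor : ∀ i → e i ℕ.* Q (d i) ≡ length units
      cofactor i = ≡.trans (Q-div*Q≡Q (d∣n i))
        (ℕ.suc-injective (≡.trans (suc-Q n) (≡.trans (≡.sym |xs|≡q^n) (≡.sym suc-length-units))))
      norms : ∀ i j → a i ^ (Q (d i) div gcd (Q (d i)) (Q (d j)))
                    ≈ a j ^ (Q (d j) div gcd (Q (d i)) (Q (d j)))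
      norms i j = ≡.subst (λ g → a i ^ (Q (d i) div g) ≈ a j ^ (Q (d j) div g)) (Q-gcd (d i) (d j))
        (trans (reflexive (≡.sym (pow≡^ (a i) (Q (d i) div Q (gcd (d i) (d j))))))
          (trans (norms-agree i j) (reflexive (pow≡^ (a j) (Q (d j) div Q (gcd (d i) (d j)))))))

-- Imported only here: the _^_ of Data.Nat would clash with the power of the ring above.
open import Data.Nat using (ℕ; _^_; _∸_; _≤_; _<_)
open import Data.Nat.Divisibility using (_∣_)
open import Data.Nat.GCD using (gcd)
open import Data.Product using (∃; _×_)
open import Data.List using (List; length; tabulate; foldr)
open import Data.Fin as Fin using (Fin)
open import Relation.Nullary using (¬_)
open import Relation.Binary using (Decidable)
open import Relation.Binary.PropositionalEquality using (_≡_)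
open import Data.Nat using (zero; suc; NonZero; NonTrivial; >-nonZero)
open Arithmetic using (prime-power⇒nonTrivial)

lemma1 : ∀ {c ℓ} (F : CommutativeRing c ℓ) →
    (_≈?_ : Decidable (CommutativeRing._≈_ F)) → FieldNotions.IsField F →
    (q n : ℕ) → IsPrimePower q → 1 ≤ n →
    (xs : List (CommutativeRing.Carrier F)) → FieldNotions.IsEnumeration F xs → length xs ≡ q ^ n →
    (k : ℕ) → 1 ≤ k → (d : Fin k → ℕ) →
    (∀ i j → i Fin.< j → d i < d j) → (∀ i → d i ∣ n) →
    (a : Fin k → CommutativeRing.Carrier F) → (∀ i → FieldNotions.InUnitsOfSubfield F q (d i) (a i)) →
    (∀ i j → CommutativeRing._≈_ F (FieldNotions.norm F q (d i) (gcd (d i) (d j)) (a i))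
                     (FieldNotions.norm F q (d j) (gcd (d i) (d j)) (a j))) →
    (∃ λ α → FieldNotions.IsSolution F q n k d a α)
      × (FieldNotions.countSolutions F _≈?_ xs q n k d a
           ≡ foldr gcd 0 (tabulate (λ i → (q ^ n ∸ 1) div (q ^ d i ∸ 1))))
lemma1 _ _ _ _ _ _ _ _ _ _ zero () _ _ _ _ _ _
lemma1 F _≈?_ isField q n q-pp n≥1 xs enum |xs|≡q^n (suc k) _ d _ d∣n a a∈F* norms-agree =
  norm-equations q n |xs|≡q^n d a d∣n a∈F* norms-agree
  where
  open FieldTheory.Finite F isField _≈?_ xs enum using (norm-equations)
  instance
    q>1 : NonTrivial q
    q>1 = prime-power⇒nonTrivial q-pp
    n≢0 : NonZero n
    n≢0 = >-nonZero n≥1
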